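{- Work in $\mathsf{IKP} + \mathsf{\Delta_0\text{ - }BTEE}_M$. Let $K$ be a transitive set such that $K\models \Delta_0\text{ -Separation}$ and $\omega\in K$, and let $j\colon V\to M$ be a $\Delta_0$-elementary embedding whose critical point is $K$. Then $K\models \mathsf{IZF}$.
   Context: All theories use intuitionistic logic. $\mathsf{IKP}$ consists of Extensionality, Pairing, Union, Infinity, Set Induction (for all formulas), $\Delta_0$-Collection and $\Delta_0$-Separation. $\mathsf{IZF}$ consists of Extensionality, Pairing, Union, Infinity, Set Induction, Separation (for all formulas), Collection and Power Set. The language is $\{\in\}$ extended by a unary function symbol $j$ and a unary predicate symbol $M$. $\mathsf{IKP}+\mathsf{\Delta_0\text{ - }BTEE}_M$ asserts the axioms of $\mathsf{IKP}$ (no instances of Separation, Collection or Set Induction for formulas involving $j$ are needed), that $M$ is a transitive class ($\forall x(M(x)\to\forall y\in x\, M(y))$), $\forall x\, M(j(x))$, $M\models\mathsf{IKP}$, that $j$ is $\Delta_0$-elementary, i.e. $\forall\vec x\,[\phi(\vec x)\leftrightarrow \phi^M(j(\vec x))]$ for every $\Delta_0$ $\in$-formula $\phi$, and that $j$ has a critical point. A critical point of $j$ is a transitive set $K$ with $K\in j(K)$ and $j(x)=x$ for all $x\in K$. -}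

module Defs where

-- Semantic (propositions-as-types) rendering of intuitionistic first-order
-- set theory in the language {∈, =} (plus j and M at the level of the
-- structure).

open import Data.Nat using (ℕ; zero; suc)
open import Data.Product using (Σ; _×_; _,_)
open import Data.Sum using (_⊎_)
open import Data.Empty using (⊥)
open import Data.Unit using (⊤)
open import Function using (_∘_)

infix 3 _↔_
_↔_ : Set → Set → Set
A ↔ B = (A → B) × (B → A)

record Structure : Set₁ where
  field
    V   : Set
    _≐_ : V → V → Set
    _∈_ : V → V → Set
    j   : V → V
    M   : V → Set
  infix 4 _≐_ _∈_

-- Syntax of ∈-formulas (de Bruijn indices; variable 0 is the innermost bound one).
data Fm : Set where
  _∈'_ : ℕ → ℕ → Fm
  _≐'_ : ℕ → ℕ → Fm
  ⊥'   : Fm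
  _∧'_ : Fm → Fm → Fm
  _∨'_ : Fm → Fm → Fm
  _⇒'_ : Fm → Fm → Fm
  ∀'   : Fm → Fm
  ∃'   : Fm → Fm
  -- bounded quantifiers  ∀x ∈ v_n . φ  and  ∃x ∈ v_n . φ  (n refers to the
  -- context outside the binder); abbreviations for ∀x (x ∈ v_n → φ), ∃x (x ∈ v_n ∧ φ)
  ∀∈   : ℕ → Fm → Fm
  ∃∈   : ℕ → Fm → Fm

data IsΔ0 : Fm → Set where
  d∈ : ∀ m n → IsΔ0 (m ∈' n)
  d≐ : ∀ m n → IsΔ0 (m ≐' n)
  d⊥ : IsΔ0 ⊥'
  d∧ : ∀ {φ ψ} → IsΔ0 φ → IsΔ0 ψ → IsΔ0 (φ ∧' ψ)
  d∨ : ∀ {φ ψ} → IsΔ0 φ → IsΔ0 ψ → IsΔ0 (φ ∨' ψ)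
  d⇒ : ∀ {φ ψ} → IsΔ0 φ → IsΔ0 ψ → IsΔ0 (φ ⇒' ψ)
  d∀∈ : ∀ n {φ} → IsΔ0 φ → IsΔ0 (∀∈ n φ)
  d∃∈ : ∀ n {φ} → IsΔ0 φ → IsΔ0 (∃∈ n φ)

module _ (S : Structure) where
  open Structure S

  _∷ₑ_ : V → (ℕ → V) → (ℕ → V)
  (x ∷ₑ ρ) zero    = x
  (x ∷ₑ ρ) (suc n) = ρ n

  Sat : (V → Set) → Fm → (ℕ → V) → Set
  Sat C (m ∈' n) ρ = ρ m ∈ ρ n
  Sat C (m ≐' n) ρ = ρ m ≐ ρ n
  Sat C ⊥' ρ = ⊥
  Sat C (φ ∧' ψ) ρ = Sat C φ ρ × Sat C ψ ρ
  Sat C (φ ∨' ψ) ρ = Sat C φ ρ ⊎ Sat C ψ ρ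
  Sat C (φ ⇒' ψ) ρ = Sat C φ ρ → Sat C ψ ρ
  Sat C (∀' φ) ρ = (x : V) → C x → Sat C φ (x ∷ₑ ρ)
  Sat C (∃' φ) ρ = Σ V λ x → C x × Sat C φ (x ∷ₑ ρ)
  Sat C (∀∈ n φ) ρ = (x : V) → C x → x ∈ ρ n → Sat C φ (x ∷ₑ ρ)
  Sat C (∃∈ n φ) ρ = Σ V λ x → C x × (x ∈ ρ n × Sat C φ (x ∷ₑ ρ))

  All : V → Set
  All _ = ⊤

  Env : (V → Set) → Set
  Env C = Σ (ℕ → V) λ ρ → (n : ℕ) → C (ρ n)

  Extensionality : (V → Set) → Set
  Extensionality C = (x y : V) → C x → C y →
    ((z : V) → C z → (z ∈ x ↔ z ∈ y)) → x ≐ y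

  Pairing : (V → Set) → Set
  Pairing C = (a b : V) → C a → C b → Σ V λ c → C c × (a ∈ c × b ∈ c)

  Union : (V → Set) → Set
  Union C = (a : V) → C a → Σ V λ u → C u ×
    ((y x : V) → C y → C x → y ∈ a → x ∈ y → x ∈ u)

  Ind : (V → Set) → V → Set
  Ind C w =
    (Σ V λ e → C e × (e ∈ w × ((z : V) → C z → z ∈ e → ⊥))) ×
    ((x : V) → C x → x ∈ w → Σ V λ y → C y × (y ∈ w ×
       ((z : V) → C z → (z ∈ y ↔ (z ∈ x ⊎ z ≐ x)))))

  IsOmega : (V → Set) → V → Set
  IsOmega C w = Ind C w × ((v : V) → C v → Ind C v → (z : V) → C z → z ∈ w → z ∈ v)

  Infinity : (V → Set) → Set
  Infinity C = Σ V λ w → C w × IsOmega C w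

  SetInduction : (V → Set) → Set
  SetInduction C = (φ : Fm) → (ρ : Env C) →
    ((x : V) → C x → ((y : V) → C y → y ∈ x → Sat C φ (y ∷ₑ Σ.proj₁ ρ)) → Sat C φ (x ∷ₑ Σ.proj₁ ρ)) →
    (x : V) → C x → Sat C φ (x ∷ₑ Σ.proj₁ ρ)

  SepInstance : (V → Set) → Fm → Set
  SepInstance C φ = (ρ : Env C) → (a : V) → C a → Σ V λ b → C b ×
    ((x : V) → C x → (x ∈ b ↔ (x ∈ a × Sat C φ (x ∷ₑ Σ.proj₁ ρ))))

  -- Collection instance for φ(x, y, params)  (y is variable 0, x is variable 1)
  CollInstance : (V → Set) → Fm → Set
  CollInstance C φ = (ρ : Env C) → (a : V) → C a →
    ((x : V) → C x → x ∈ a → Σ V λ y → C y × Sat C φ (y ∷ₑ (x ∷ₑ Σ.proj₁ ρ))) →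
    Σ V λ b → C b × ((x : V) → C x → x ∈ a → Σ V λ y → C y × (y ∈ b × Sat C φ (y ∷ₑ (x ∷ₑ Σ.proj₁ ρ))))

  Δ0Separation : (V → Set) → Set
  Δ0Separation C = (φ : Fm) → IsΔ0 φ → SepInstance C φ

  Δ0Collection : (V → Set) → Set
  Δ0Collection C = (φ : Fm) → IsΔ0 φ → CollInstance C φ

  Separation : (V → Set) → Set
  Separation C = (φ : Fm) → SepInstance C φ

  Collection : (V → Set) → Set
  Collection C = (φ : Fm) → CollInstance C φ

  PowerSet : (V → Set) → Set
  PowerSet C = (a : V) → C a → Σ V λ p → C p ×
    ((x : V) → C x → ((z : V) → C z → z ∈ x → z ∈ a) → x ∈ p)

  IKP : (V → Set) → Set
  IKP C = Extensionality C × Pairing C × Union C × Infinity C ×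
          SetInduction C × Δ0Collection C × Δ0Separation C

  IZF : (V → Set) → Set
  IZF C = Extensionality C × Pairing C × Union C × Infinity C ×
          SetInduction C × Separation C × Collection C × PowerSet C

  Elems : V → V → Set
  Elems K x = x ∈ K

  Transitive : V → Set
  Transitive K = (x : V) → x ∈ K → (y : V) → y ∈ x → y ∈ K

  CriticalPoint : V → Set
  CriticalPoint K = Transitive K × (K ∈ j K × ((x : V) → x ∈ K → j x ≐ x))

  EqualityAxioms : Set
  EqualityAxioms =
    ((x : V) → x ≐ x) ×
    ((x y : V) → x ≐ y → y ≐ x) ×
    ((x y z : V) → x ≐ y → y ≐ z → x ≐ z) ×
    ((x x' y : V) → x ≐ x' → x ∈ y → x' ∈ y) ×
    ((x y y' : V) → y ≐ y' → x ∈ y → x ∈ y') ×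
    ((x y : V) → x ≐ y → j x ≐ j y) ×
    ((x y : V) → x ≐ y → M x → M y)

  IKP+Δ0-BTEE : Set
  IKP+Δ0-BTEE =
    EqualityAxioms ×
    IKP All ×
    ((x : V) → M x → (y : V) → y ∈ x → M y) ×
    ((x : V) → M (j x)) ×
    IKP M ×
    ((φ : Fm) → IsΔ0 φ → (ρ : ℕ → V) → Sat All φ ρ ↔ Sat M φ (j ∘ ρ)) ×
    (Σ V λ K → CriticalPoint K)

-- Every axiom is reflected through j. As j fixes the elements of K and sends K to
-- j K, Δ0-elementarity transfers a Δ0 statement about K with parameters in K to the
-- same statement about j K. Satisfaction in K is itself Δ0 once φ is relativized to
-- K, so K ⊨ φ(p) iff j K ⊨ φ(p). To find a set in K with a Δ0 property it thus
-- suffices to find one in j K, and K ∈ j K usually is one: a collecting set for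
-- Collection, a cover of the subsets of a for Power Set (the subsets of a lying in
-- j K are in K since j fixes them). Separation for arbitrary φ comes from
-- Δ0-separation in K for the Δ0 formulas "k ⊨ φ" (k ∈ K), carried over to j K and
-- instantiated at k = K.

module Submission where

open import Defs
open import Data.Nat using (ℕ; zero; suc; _+_)
open import Data.Product using (Σ; _×_; _,_; proj₁; proj₂) renaming (map to ×-map)
open import Data.Sum using (_⊎_; inj₁; inj₂) renaming (map to ⊎-map)
open import Data.Unit using (⊤; tt)
open import Function using (_∘_; const)
open import Relation.Binary.PropositionalEquality using (_≡_; refl; sym; subst; subst₂)

infixr 2 _⟨↔⟩_

↔-refl : {A : Set} → A ↔ A
↔-refl = (λ a → a) , (λ a → a)

↔-sym : {A B : Set} → A ↔ B → B ↔ A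
↔-sym (f , g) = g , f

_⟨↔⟩_ : {A B C : Set} → A ↔ B → B ↔ C → A ↔ C
(f , g) ⟨↔⟩ (f′ , g′) = f′ ∘ f , g ∘ g′

×-↔ : {A A′ B B′ : Set} → A ↔ A′ → B ↔ B′ → (A × B) ↔ (A′ × B′)
×-↔ (f , g) (f′ , g′) = ×-map f f′ , ×-map g g′

×-↔ʳ : {A B B′ : Set} → (A → B ↔ B′) → (A × B) ↔ (A × B′)
×-↔ʳ B↔B′ = (λ { (a , b) → a , proj₁ (B↔B′ a) b }) , (λ { (a , b′) → a , proj₂ (B↔B′ a) b′ })

⊎-↔ : {A A′ B B′ : Set} → A ↔ A′ → B ↔ B′ → (A ⊎ B) ↔ (A′ ⊎ B′)
⊎-↔ (f , g) (f′ , g′) = ⊎-map f f′ , ⊎-map g g′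

→-↔ : {A A′ B B′ : Set} → A ↔ A′ → B ↔ B′ → (A → B) ↔ (A′ → B′)
→-↔ (f , g) (f′ , g′) = (λ h → f′ ∘ h ∘ g) , (λ h → g′ ∘ h ∘ f)

liftRen : (ℕ → ℕ) → ℕ → ℕ
liftRen h zero    = zero
liftRen h (suc n) = suc (h n)

weakenAt : ℕ → ℕ → ℕ → ℕ
weakenAt zero    k = k +_
weakenAt (suc p) k = liftRen (weakenAt p k)

infix 3 _⇔'_
_⇔'_ : Fm → Fm → Fm
φ ⇔' ψ = (φ ⇒' ψ) ∧' (ψ ⇒' φ)

relativize : (ℕ → ℕ) → ℕ → Fm → Fm
relativize h k (m ∈' n) = h m ∈' h n
relativize h k (m ≐' n) = h m ≐' h n
relativize h k ⊥'       = ⊥'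
relativize h k (φ ∧' ψ) = relativize h k φ ∧' relativize h k ψ
relativize h k (φ ∨' ψ) = relativize h k φ ∨' relativize h k ψ
relativize h k (φ ⇒' ψ) = relativize h k φ ⇒' relativize h k ψ
relativize h k (∀' φ)   = ∀∈ k (relativize (liftRen h) (suc k) φ)
relativize h k (∃' φ)   = ∃∈ k (relativize (liftRen h) (suc k) φ)
relativize h k (∀∈ n φ) = ∀∈ (h n) ((0 ∈' suc k) ⇒' relativize (liftRen h) (suc k) φ)
relativize h k (∃∈ n φ) = ∃∈ (h n) ((0 ∈' suc k) ∧' relativize (liftRen h) (suc k) φ)

IsΔ0-relativize : ∀ h k φ → IsΔ0 (relativize h k φ)
IsΔ0-relativize h k (m ∈' n) = d∈ (h m) (h n)
IsΔ0-relativize h k (m ≐' n) = d≐ (h m) (h n)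
IsΔ0-relativize h k ⊥'       = d⊥
IsΔ0-relativize h k (φ ∧' ψ) = d∧ (IsΔ0-relativize h k φ) (IsΔ0-relativize h k ψ)
IsΔ0-relativize h k (φ ∨' ψ) = d∨ (IsΔ0-relativize h k φ) (IsΔ0-relativize h k ψ)
IsΔ0-relativize h k (φ ⇒' ψ) = d⇒ (IsΔ0-relativize h k φ) (IsΔ0-relativize h k ψ)
IsΔ0-relativize h k (∀' φ)   = d∀∈ k (IsΔ0-relativize (liftRen h) (suc k) φ)
IsΔ0-relativize h k (∃' φ)   = d∃∈ k (IsΔ0-relativize (liftRen h) (suc k) φ)
IsΔ0-relativize h k (∀∈ n φ) =
  d∀∈ (h n) (d⇒ (d∈ 0 (suc k)) (IsΔ0-relativize (liftRen h) (suc k) φ))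
IsΔ0-relativize h k (∃∈ n φ) =
  d∃∈ (h n) (d∧ (d∈ 0 (suc k)) (IsΔ0-relativize (liftRen h) (suc k) φ))

-- With v₀ = k, v₁ = c, v₂ = a: some b ∈ c agrees on c with {x ∈ a | k ⊨ φ(x, v₃, v₄, …)}.
separationFm : Fm → Fm
separationFm φ = ∃∈ 1 (∀∈ 2 ((0 ∈' 1) ⇔' ((0 ∈' 4) ∧' relativize (weakenAt 1 4) 2 φ)))

IsΔ0-separationFm : ∀ φ → IsΔ0 (separationFm φ)
IsΔ0-separationFm φ =
  d∃∈ 1 (d∀∈ 2 (d∧ (d⇒ (d∈ 0 1) (d∧ (d∈ 0 4) Δ0-φ)) (d⇒ (d∧ (d∈ 0 4) Δ0-φ) (d∈ 0 1))))
  where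
    Δ0-φ : IsΔ0 (relativize (weakenAt 1 4) 2 φ)
    Δ0-φ = IsΔ0-relativize (weakenAt 1 4) 2 φ

module Semantics (S : Structure) where
  open Structure S

  infixr 5 _∷_
  _∷_ : V → (ℕ → V) → ℕ → V
  _∷_ = _∷ₑ_ S

  infix 4 _⊆_
  _⊆_ : V → V → Set
  x ⊆ y = (z : V) → z ∈ x → z ∈ y

  TransitiveClass : (V → Set) → Set
  TransitiveClass C = (x : V) → C x → (y : V) → y ∈ x → C y

  liftRen-pointwise : ∀ {h} {τ σ : ℕ → V} → (∀ n → τ (h n) ≡ σ n) →
    (x : V) → ∀ n → (x ∷ τ) (liftRen h n) ≡ (x ∷ σ) n
  liftRen-pointwise e x zero    = refl
  liftRen-pointwise e x (suc n) = e n

  mutual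
    Sat-relativize : ∀ φ h k (τ σ : ℕ → V) → (∀ n → τ (h n) ≡ σ n) →
      Sat S (Elems S (τ k)) φ σ ↔ Sat S (All S) (relativize h k φ) τ
    Sat-relativize (m ∈' n) h k τ σ e = subst₂ _∈_ (sym (e m)) (sym (e n)) , subst₂ _∈_ (e m) (e n)
    Sat-relativize (m ≐' n) h k τ σ e = subst₂ _≐_ (sym (e m)) (sym (e n)) , subst₂ _≐_ (e m) (e n)
    Sat-relativize ⊥'       h k τ σ e = ↔-refl
    Sat-relativize (φ ∧' ψ) h k τ σ e = ×-↔ (Sat-relativize φ h k τ σ e) (Sat-relativize ψ h k τ σ e)
    Sat-relativize (φ ∨' ψ) h k τ σ e = ⊎-↔ (Sat-relativize φ h k τ σ e) (Sat-relativize ψ h k τ σ e)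
    Sat-relativize (φ ⇒' ψ) h k τ σ e = →-↔ (Sat-relativize φ h k τ σ e) (Sat-relativize ψ h k τ σ e)
    Sat-relativize (∀' φ) h k τ σ e =
      (λ f x _ x∈k → proj₁ (Sat-relativize-∷ φ h k τ σ e x) (f x x∈k)) ,
      (λ f x x∈k → proj₂ (Sat-relativize-∷ φ h k τ σ e x) (f x tt x∈k))
    Sat-relativize (∃' φ) h k τ σ e =
      (λ { (x , x∈k , s) → x , tt , x∈k , proj₁ (Sat-relativize-∷ φ h k τ σ e x) s }) ,
      (λ { (x , _ , x∈k , s) → x , x∈k , proj₂ (Sat-relativize-∷ φ h k τ σ e x) s })
    Sat-relativize (∀∈ n φ) h k τ σ e =
      (λ f x _ x∈n x∈k → proj₁ (Sat-relativize-∷ φ h k τ σ e x) (f x x∈k (subst (x ∈_) (e n) x∈n))) ,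
      (λ f x x∈k x∈n → proj₂ (Sat-relativize-∷ φ h k τ σ e x) (f x tt (subst (x ∈_) (sym (e n)) x∈n) x∈k))
    Sat-relativize (∃∈ n φ) h k τ σ e =
      (λ { (x , x∈k , x∈n , s) →
             x , tt , subst (x ∈_) (sym (e n)) x∈n , x∈k , proj₁ (Sat-relativize-∷ φ h k τ σ e x) s }) ,
      (λ { (x , _ , x∈n , x∈k , s) →
             x , x∈k , subst (x ∈_) (e n) x∈n , proj₂ (Sat-relativize-∷ φ h k τ σ e x) s })

    Sat-relativize-∷ : ∀ φ h k (τ σ : ℕ → V) → (∀ n → τ (h n) ≡ σ n) → (x : V) →
      Sat S (Elems S (τ k)) φ (x ∷ σ) ↔ Sat S (All S) (relativize (liftRen h) (suc k) φ) (x ∷ τ)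
    Sat-relativize-∷ φ h k τ σ e x =
      Sat-relativize φ (liftRen h) (suc k) (x ∷ τ) (x ∷ σ) (liftRen-pointwise e x)

  C-∷ : ∀ (C : V → Set) {x ρ} → C x → (∀ n → C (ρ n)) → ∀ n → C ((x ∷ ρ) n)
  C-∷ C x∈C ρ∈C zero    = x∈C
  C-∷ C x∈C ρ∈C (suc n) = ρ∈C n

  SeparatedIn : V → V → (V → Set) → Set
  SeparatedIn c a P = Σ V λ b → b ∈ c × ((x : V) → x ∈ c → (x ∈ b ↔ (x ∈ a × P x)))

  SeparatedIn-cong : ∀ {c a} {P Q : V → Set} → (∀ x → x ∈ a → P x ↔ Q x) →
    SeparatedIn c a P → SeparatedIn c a Q
  SeparatedIn-cong P↔Q (b , b∈c , sep) = b , b∈c , λ x x∈c → sep x x∈c ⟨↔⟩ ×-↔ʳ (P↔Q x)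

  Sat-separationFm : ∀ φ (ρ : ℕ → V) (k c a : V) →
    Sat S (All S) (separationFm φ) (k ∷ c ∷ a ∷ ρ) ↔ SeparatedIn c a (λ x → Sat S (Elems S k) φ (x ∷ ρ))
  Sat-separationFm φ ρ k c a =
    (λ { (b , _ , b∈c , sep) → b , b∈c , λ x x∈c → sep x tt x∈c ⟨↔⟩ ×-↔ʳ (λ _ → ↔-sym (⊨φ↔ x b)) }) ,
    (λ { (b , b∈c , sep) → b , tt , b∈c , λ x _ x∈c → sep x x∈c ⟨↔⟩ ×-↔ʳ (λ _ → ⊨φ↔ x b) })
    where
      ⊨φ↔ : (x b : V) →
        Sat S (Elems S k) φ (x ∷ ρ) ↔ Sat S (All S) (relativize (weakenAt 1 4) 2 φ) (x ∷ b ∷ k ∷ c ∷ a ∷ ρ)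
      ⊨φ↔ x b = Sat-relativize φ (weakenAt 1 4) 2 (x ∷ b ∷ k ∷ c ∷ a ∷ ρ) (x ∷ ρ)
        λ { zero → refl ; (suc n) → refl }

  module Absoluteness (C : V → Set) (C-transitive : TransitiveClass C) where
    Sat-Δ0-absolute : ∀ {φ} → IsΔ0 φ → (ρ : ℕ → V) → (∀ n → C (ρ n)) →
      Sat S C φ ρ ↔ Sat S (All S) φ ρ
    Sat-Δ0-absolute (d∈ m n)  ρ ρ∈C = ↔-refl
    Sat-Δ0-absolute (d≐ m n)  ρ ρ∈C = ↔-refl
    Sat-Δ0-absolute d⊥        ρ ρ∈C = ↔-refl
    Sat-Δ0-absolute (d∧ p q)  ρ ρ∈C = ×-↔ (Sat-Δ0-absolute p ρ ρ∈C) (Sat-Δ0-absolute q ρ ρ∈C)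
    Sat-Δ0-absolute (d∨ p q)  ρ ρ∈C = ⊎-↔ (Sat-Δ0-absolute p ρ ρ∈C) (Sat-Δ0-absolute q ρ ρ∈C)
    Sat-Δ0-absolute (d⇒ p q)  ρ ρ∈C = →-↔ (Sat-Δ0-absolute p ρ ρ∈C) (Sat-Δ0-absolute q ρ ρ∈C)
    Sat-Δ0-absolute (d∀∈ n p) ρ ρ∈C =
      (λ f x _ x∈n → let x∈C = C-transitive (ρ n) (ρ∈C n) x x∈n in
         proj₁ (Sat-Δ0-absolute p (x ∷ ρ) (C-∷ C x∈C ρ∈C)) (f x x∈C x∈n)) ,
      (λ f x x∈C x∈n → proj₂ (Sat-Δ0-absolute p (x ∷ ρ) (C-∷ C x∈C ρ∈C)) (f x tt x∈n))
    Sat-Δ0-absolute (d∃∈ n p) ρ ρ∈C =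
      (λ { (x , x∈C , x∈n , s) → x , tt , x∈n , proj₁ (Sat-Δ0-absolute p (x ∷ ρ) (C-∷ C x∈C ρ∈C)) s }) ,
      (λ { (x , _ , x∈n , s) → let x∈C = C-transitive (ρ n) (ρ∈C n) x x∈n in
             x , x∈C , x∈n , proj₂ (Sat-Δ0-absolute p (x ∷ ρ) (C-∷ C x∈C ρ∈C)) s })

  open Absoluteness public

  subsetsIn : Δ0Separation S (All S) → (c a : V) → Σ V λ s → (x : V) → x ∈ s ↔ (x ∈ c × x ⊆ a)
  subsetsIn Δ0-sep c a =
    let (s , _ , s-spec) = Δ0-sep (∀∈ 0 (0 ∈' 2)) (d∀∈ 0 (d∈ 0 2)) (const a , const tt) c tt in
    s , λ x → s-spec x tt ⟨↔⟩ ×-↔ʳ (λ _ → (λ x⊆a z → x⊆a z tt) , (λ x⊆a z _ → x⊆a z))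

  Extensionality-transitive : Extensionality S (All S) → (K : V) → Transitive S K →
    Extensionality S (Elems S K)
  Extensionality-transitive ext K K-tr x y x∈K y∈K same = ext x y tt tt λ z _ →
    (λ z∈x → proj₁ (same z (K-tr x x∈K z z∈x)) z∈x) ,
    (λ z∈y → proj₂ (same z (K-tr y y∈K z z∈y)) z∈y)

  -- Induction on x for the formula "x ∈ K → K ⊨ φ(x)".
  SetInduction-set : SetInduction S (All S) → (K : V) → SetInduction S (Elems S K)
  SetInduction-set ind K φ (ρ , ρ∈K) step x x∈K =
    proj₂ (⊨K↔ x) (ind ((0 ∈' 1) ⇒' relativize (weakenAt 1 1) 1 φ) ((K ∷ ρ) , const tt)
      (λ y _ ih y∈K → proj₁ (⊨K↔ y) (step y y∈K λ z z∈K z∈y → proj₂ (⊨K↔ z) (ih z tt z∈y z∈K)))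
      x tt x∈K)
    where
      ⊨K↔ : (y : V) → Sat S (Elems S K) φ (y ∷ ρ) ↔ Sat S (All S) (relativize (weakenAt 1 1) 1 φ) (y ∷ K ∷ ρ)
      ⊨K↔ y = Sat-relativize φ (weakenAt 1 1) 1 (y ∷ K ∷ ρ) (y ∷ ρ) λ { zero → refl ; (suc n) → refl }

  module WithEquality
    (≐-refl : (x : V) → x ≐ x)
    (≐-sym : (x y : V) → x ≐ y → y ≐ x)
    (≐-trans : (x y z : V) → x ≐ y → y ≐ z → x ≐ z)
    (≐-∈ˡ : (x x′ y : V) → x ≐ x′ → x ∈ y → x′ ∈ y)
    (≐-∈ʳ : (x y y′ : V) → y ≐ y′ → x ∈ y → x ∈ y′) where

    ≐-∷ : ∀ x {ρ σ : ℕ → V} → (∀ n → ρ n ≐ σ n) → ∀ n → (x ∷ ρ) n ≐ (x ∷ σ) n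
    ≐-∷ x e zero    = ≐-refl x
    ≐-∷ x e (suc n) = e n

    Sat-≐ : ∀ {C} φ (ρ σ : ℕ → V) → (∀ n → ρ n ≐ σ n) → Sat S C φ ρ → Sat S C φ σ
    Sat-≐ (m ∈' n) ρ σ e s = ≐-∈ʳ _ _ _ (e n) (≐-∈ˡ _ _ _ (e m) s)
    Sat-≐ (m ≐' n) ρ σ e s = ≐-trans _ _ _ (≐-sym _ _ (e m)) (≐-trans _ _ _ s (e n))
    Sat-≐ ⊥' ρ σ e s = s
    Sat-≐ (φ ∧' ψ) ρ σ e (s , t) = Sat-≐ φ ρ σ e s , Sat-≐ ψ ρ σ e t
    Sat-≐ (φ ∨' ψ) ρ σ e (inj₁ s) = inj₁ (Sat-≐ φ ρ σ e s)
    Sat-≐ (φ ∨' ψ) ρ σ e (inj₂ t) = inj₂ (Sat-≐ ψ ρ σ e t)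
    Sat-≐ (φ ⇒' ψ) ρ σ e f = Sat-≐ ψ ρ σ e ∘ f ∘ Sat-≐ φ σ ρ (λ n → ≐-sym _ _ (e n))
    Sat-≐ (∀' φ) ρ σ e f = λ x x∈C → Sat-≐ φ (x ∷ ρ) (x ∷ σ) (≐-∷ x e) (f x x∈C)
    Sat-≐ (∃' φ) ρ σ e (x , x∈C , s) = x , x∈C , Sat-≐ φ (x ∷ ρ) (x ∷ σ) (≐-∷ x e) s
    Sat-≐ (∀∈ n φ) ρ σ e f = λ x x∈C x∈n →
      Sat-≐ φ (x ∷ ρ) (x ∷ σ) (≐-∷ x e) (f x x∈C (≐-∈ʳ _ _ _ (≐-sym _ _ (e n)) x∈n))
    Sat-≐ (∃∈ n φ) ρ σ e (x , x∈C , x∈n , s) =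
      x , x∈C , ≐-∈ʳ _ _ _ (e n) x∈n , Sat-≐ φ (x ∷ ρ) (x ∷ σ) (≐-∷ x e) s

    Sat-≐-↔ : ∀ {C} φ (ρ σ : ℕ → V) → (∀ n → ρ n ≐ σ n) → Sat S C φ ρ ↔ Sat S C φ σ
    Sat-≐-↔ φ ρ σ e = Sat-≐ φ ρ σ e , Sat-≐ φ σ ρ (λ n → ≐-sym _ _ (e n))

    Ind-absolute : (K : V) → Transitive S K → (w : V) → w ∈ K → Ind S (Elems S K) w ↔ Ind S (All S) w
    Ind-absolute K K-tr w w∈K =
      (λ { ((e , e∈K , e∈w , e-empty) , succ) →
             (e , tt , e∈w , λ z _ z∈e → e-empty z (K-tr e e∈K z z∈e) z∈e) ,
             λ x _ x∈w → let x∈K = K-tr w w∈K x x∈w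
                             (y , y∈K , y∈w , y-succ) = succ x x∈K x∈w in
               y , tt , y∈w , λ z _ →
                 (λ z∈y → proj₁ (y-succ z (K-tr y y∈K z z∈y)) z∈y) ,
                 (λ z∈x⁺ → proj₂ (y-succ z (successor⊆K x∈K z∈x⁺)) z∈x⁺) }) ,
      (λ { ((e , _ , e∈w , e-empty) , succ) →
             (e , K-tr w w∈K e e∈w , e∈w , λ z _ → e-empty z tt) ,
             λ x _ x∈w → let (y , _ , y∈w , y-succ) = succ x tt x∈w in
               y , K-tr w w∈K y y∈w , y∈w , λ z _ → y-succ z tt })
      where
        successor⊆K : ∀ {x z} → x ∈ K → z ∈ x ⊎ z ≐ x → z ∈ K
        successor⊆K {x} x∈K (inj₁ z∈x) = K-tr x x∈K _ z∈x
        successor⊆K {x} x∈K (inj₂ z≐x) = ≐-∈ˡ x _ K (≐-sym _ x z≐x) x∈K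

    Infinity-transitive : (K : V) → Transitive S K → (ω : V) → IsOmega S (All S) ω → ω ∈ K →
      Infinity S (Elems S K)
    Infinity-transitive K K-tr ω (ω-ind , ω-least) ω∈K =
      ω , ω∈K , proj₂ (Ind-absolute K K-tr ω ω∈K) ω-ind ,
      λ v v∈K v-ind z _ → ω-least v tt (proj₁ (Ind-absolute K K-tr v v∈K) v-ind) z tt

    module Embedding
      (M-transitive : TransitiveClass M)
      (j∈M : (x : V) → M (j x))
      (elementary : (φ : Fm) → IsΔ0 φ → (ρ : ℕ → V) → Sat S (All S) φ ρ ↔ Sat S M φ (j ∘ ρ)) where

      infix 4 _≐ⱼ_
      _≐ⱼ_ : (ℕ → V) → (ℕ → V) → Set
      σ ≐ⱼ τ = ∀ n → j (σ n) ≐ τ n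

      infixr 5 _∷ⱼ_
      _∷ⱼ_ : ∀ {x y σ τ} → j x ≐ y → σ ≐ⱼ τ → (x ∷ σ) ≐ⱼ (y ∷ τ)
      (x≐ ∷ⱼ σ≐) zero    = x≐
      (x≐ ∷ⱼ σ≐) (suc n) = σ≐ n

      j-elementary : ∀ {θ} → IsΔ0 θ → {σ τ : ℕ → V} → σ ≐ⱼ τ → Sat S (All S) θ σ ↔ Sat S (All S) θ τ
      j-elementary {θ} d {σ} {τ} σ≐τ =
        elementary θ d σ ⟨↔⟩
        Sat-Δ0-absolute M M-transitive d (j ∘ σ) (j∈M ∘ σ) ⟨↔⟩
        Sat-≐-↔ θ (j ∘ σ) τ σ≐τ

      j-image : (σ : ℕ → V) → σ ≐ⱼ j ∘ σ
      j-image σ n = ≐-refl (j (σ n))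

      j-∈ : (x y : V) → x ∈ y ↔ j x ∈ j y
      j-∈ x y = elementary (0 ∈' 1) (d∈ 0 1) (x ∷ y ∷ const x)

      j-⊆ : (x y : V) → x ⊆ y → j x ⊆ j y
      j-⊆ x y x⊆y z = proj₁ (j-elementary (d∀∈ 0 (d∈ 0 2)) (j-image (x ∷ y ∷ const x))) (λ z _ → x⊆y z) z tt

      module CriticalPoint
        (K : V) (K-transitive : Transitive S K) (K∈jK : K ∈ j K)
        (j-fixes : (x : V) → x ∈ K → j x ≐ x) where

        K-∷ : ∀ {x σ} → x ∈ K → (∀ n → σ n ∈ K) → ∀ n → (x ∷ σ) n ∈ K
        K-∷ = C-∷ (Elems S K)

        fixed : ∀ {σ} → (∀ n → σ n ∈ K) → σ ≐ⱼ σ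
        fixed σ∈K n = j-fixes _ (σ∈K n)

        Sat-K↔jK : ∀ φ (σ : ℕ → V) → (∀ n → σ n ∈ K) →
          Sat S (Elems S K) φ σ ↔ Sat S (Elems S (j K)) φ σ
        Sat-K↔jK φ σ σ∈K =
          Sat-relativize φ suc 0 (K ∷ σ) σ (λ _ → refl) ⟨↔⟩
          j-elementary (IsΔ0-relativize suc 0 φ) (≐-refl (j K) ∷ⱼ fixed σ∈K) ⟨↔⟩
          ↔-sym (Sat-relativize φ suc 0 (j K ∷ σ) σ (λ _ → refl))

        pairing : Pairing S (Elems S K)
        pairing a b a∈K b∈K =
          let (c , _ , c∈K , a∈c , b∈c) =
                proj₂ (j-elementary (d∃∈ 0 (d∧ (d∈ 2 0) (d∈ 3 0)))
                        (≐-refl (j K) ∷ⱼ j-fixes a a∈K ∷ⱼ j-fixes b b∈K ∷ⱼ fixed (const a∈K)))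
                      (K , tt , K∈jK , a∈K , b∈K)
          in c , c∈K , a∈c , b∈c

        union : Union S (Elems S K)
        union a a∈K =
          let (u , _ , u∈K , ⋃a⊆u) =
                proj₂ (j-elementary (d∃∈ 0 (d∀∈ 2 (d∀∈ 0 (d∈ 0 2))))
                        (≐-refl (j K) ∷ⱼ j-fixes a a∈K ∷ⱼ fixed (const a∈K)))
                      (K , tt , K∈jK , λ y _ y∈a x _ x∈y → K-transitive y (K-transitive a a∈K y y∈a) x x∈y)
          in u , u∈K , λ y x _ _ y∈a x∈y → ⋃a⊆u y tt y∈a x tt x∈y

        collection : Collection S (Elems S K)
        collection φ (ρ , ρ∈K) a a∈K total =
          let (b , _ , b∈K , collects) =
                proj₂ (j-elementary (d∃∈ 0 (d∀∈ 2 (d∃∈ 1 (IsΔ0-relativize (weakenAt 2 3) 3 φ))))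
                        (≐-refl (j K) ∷ⱼ j-fixes a a∈K ∷ⱼ fixed ρ∈K))
                      (K , tt , K∈jK , λ x _ x∈a →
                         let x∈K = K-transitive a a∈K x x∈a
                             (y , y∈K , s) = total x x∈K x∈a in
                         y , tt , y∈K ,
                         proj₁ (⊨φ↔ y x K (j K)) (proj₁ (Sat-K↔jK φ (y ∷ x ∷ ρ) (K-∷ y∈K (K-∷ x∈K ρ∈K))) s))
          in b , b∈K , λ x _ x∈a →
               let (y , _ , y∈b , s) = collects x tt x∈a in
               y , K-transitive b b∈K y y∈b , y∈b , proj₂ (⊨φ↔ y x b K) s
          where
            ⊨φ↔ : (y x b k : V) →
              Sat S (Elems S k) φ (y ∷ x ∷ ρ) ↔ Sat S (All S) (relativize (weakenAt 2 3) 3 φ) (y ∷ x ∷ b ∷ k ∷ a ∷ ρ)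
            ⊨φ↔ y x b k = Sat-relativize φ (weakenAt 2 3) 3 (y ∷ x ∷ b ∷ k ∷ a ∷ ρ) (y ∷ x ∷ ρ)
              λ { zero → refl ; (suc zero) → refl ; (suc (suc n)) → refl }

        separation : Δ0Separation S (Elems S K) → Separation S (Elems S K)
        separation Δ0-sep φ (ρ , ρ∈K) a a∈K =
          proj₂ (φ-Separated-elementary (≐-refl (j K)) (≐-refl (j K))) separated-by-jK-in-jK
          where
            φ-Separated : V → V → Set
            φ-Separated k c = SeparatedIn c a (λ x → Sat S (Elems S k) φ (x ∷ ρ))

            params≐ : (a ∷ ρ) ≐ⱼ (a ∷ ρ)
            params≐ = fixed (K-∷ a∈K ρ∈K)

            φ-Separated-elementary : ∀ {k c k′ c′} → j k ≐ k′ → j c ≐ c′ → φ-Separated k c ↔ φ-Separated k′ c′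
            φ-Separated-elementary {k} {c} {k′} {c′} k≐ c≐ =
              ↔-sym (Sat-separationFm φ ρ k c a) ⟨↔⟩
              j-elementary (IsΔ0-separationFm φ) (k≐ ∷ⱼ c≐ ∷ⱼ params≐) ⟨↔⟩
              Sat-separationFm φ ρ k′ c′ a

            ⊨k↔ : (k x : V) → k ∈ K → x ∈ K →
              Sat S (Elems S K) (relativize (weakenAt 1 1) 1 φ) (x ∷ k ∷ ρ) ↔ Sat S (Elems S k) φ (x ∷ ρ)
            ⊨k↔ k x k∈K x∈K =
              Sat-Δ0-absolute (Elems S K) K-transitive (IsΔ0-relativize (weakenAt 1 1) 1 φ) (x ∷ k ∷ ρ)
                (K-∷ x∈K (K-∷ k∈K ρ∈K)) ⟨↔⟩
              ↔-sym (Sat-relativize φ (weakenAt 1 1) 1 (x ∷ k ∷ ρ) (x ∷ ρ) λ { zero → refl ; (suc n) → refl })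

            separated-in-K : (k : V) → k ∈ K → φ-Separated k K
            separated-in-K k k∈K =
              SeparatedIn-cong (λ x x∈a → ⊨k↔ k x k∈K (K-transitive a a∈K x x∈a))
                (Δ0-sep (relativize (weakenAt 1 1) 1 φ) (IsΔ0-relativize (weakenAt 1 1) 1 φ)
                   ((k ∷ ρ) , K-∷ k∈K ρ∈K) a a∈K)

            separated-by-K-in-jK : φ-Separated K (j K)
            separated-by-K-in-jK =
              proj₁ (Sat-separationFm φ ρ K (j K) a)
                (proj₁ (j-elementary (d∀∈ 0 (IsΔ0-separationFm φ)) (≐-refl (j K) ∷ⱼ params≐))
                  (λ k _ k∈K → proj₂ (Sat-separationFm φ ρ k K a) (separated-in-K k k∈K))
                  K tt K∈jK)

            separated-by-jK-in-jK : φ-Separated (j K) (j K)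
            separated-by-jK-in-jK =
              SeparatedIn-cong (λ x x∈a → Sat-K↔jK φ (x ∷ ρ) (K-∷ (K-transitive a a∈K x x∈a) ρ∈K))
                separated-by-K-in-jK

        j-fixes-⊆ : Extensionality S (All S) → (a x : V) → a ∈ K → x ⊆ a → j x ≐ x
        j-fixes-⊆ ext a x a∈K x⊆a = ext (j x) x tt tt λ z _ →
          (λ z∈jx → let z∈a = ≐-∈ʳ z (j a) a (j-fixes a a∈K) (j-⊆ x a x⊆a z z∈jx)
                        jz≐z = j-fixes z (K-transitive a a∈K z z∈a) in
             proj₂ (j-∈ z x) (≐-∈ˡ z (j z) (j x) (≐-sym _ _ jz≐z) z∈jx)) ,
          (λ z∈x → let jz≐z = j-fixes z (K-transitive a a∈K z (x⊆a z z∈x)) in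
             ≐-∈ˡ (j z) z (j x) jz≐z (proj₁ (j-∈ z x) z∈x))

        ∈jK⇒∈K : Extensionality S (All S) → (a x : V) → a ∈ K → x ⊆ a → x ∈ j K → x ∈ K
        ∈jK⇒∈K ext a x a∈K x⊆a x∈jK =
          proj₂ (j-∈ x K) (≐-∈ˡ x (j x) (j K) (≐-sym _ _ (j-fixes-⊆ ext a x a∈K x⊆a)) x∈jK)

        -- S₀ = {x ∈ K | x ⊆ a} has j S₀ ⊆ K, so K ∈ j K covers j S₀.
        powerSet : Extensionality S (All S) → Δ0Separation S (All S) → PowerSet S (Elems S K)
        powerSet ext Δ0-sep a a∈K with subsetsIn Δ0-sep K a
        ... | S₀ , S₀-spec =
          let (P , _ , P∈K , S₀⊆P) =
                proj₂ (j-elementary (d∃∈ 0 (d∀∈ 2 (d∈ 0 1))) (j-image (K ∷ S₀ ∷ const S₀)))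
                      (K , tt , K∈jK , λ x _ → jS₀⊆K x)
          in P , P∈K , λ x x∈K x⊆a →
               S₀⊆P x tt (proj₂ (S₀-spec x) (x∈K , λ z z∈x → x⊆a z (K-transitive x x∈K z z∈x) z∈x))
          where
            jS₀⊆K : j S₀ ⊆ K
            jS₀⊆K x x∈jS₀ =
              let (x∈jK , x⊆a) =
                    proj₁ (j-elementary (d∀∈ 0 (d∧ (d∈ 0 2) (d∀∈ 0 (d∈ 0 4))))
                             (≐-refl (j S₀) ∷ⱼ ≐-refl (j K) ∷ⱼ j-fixes a a∈K ∷ⱼ fixed (const a∈K)))
                          (λ x _ x∈S₀ → let (x∈K , x⊆a) = proj₁ (S₀-spec x) x∈S₀ in x∈K , λ z _ → x⊆a z)
                          x tt x∈jS₀
              in ∈jK⇒∈K ext a x a∈K (λ z z∈x → x⊆a z tt z∈x) x∈jK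

open Semantics

mainTheorem1 : (S : Structure) → IKP+Δ0-BTEE S →
    (K : Structure.V S) →
    Transitive S K →
    Δ0Separation S (Elems S K) →
    (Σ (Structure.V S) λ ω → IsOmega S (All S) ω × Structure._∈_ S ω K) →
    CriticalPoint S K →
    IZF S (Elems S K)
mainTheorem1 S ((≐-refl , ≐-sym , ≐-trans , ≐-∈ˡ , ≐-∈ʳ , _) , (ext , _ , _ , _ , ind , _ , Δ0-sep) ,
                M-transitive , j∈M , _ , elementary , _)
             K K-transitive Δ0-sepK (ω , ω-isω , ω∈K) (_ , K∈jK , j-fixes) =
  Extensionality-transitive S ext K K-transitive ,
  pairing , union ,
  Infinity-transitive K K-transitive ω ω-isω ω∈K ,
  SetInduction-set S ind K ,
  separation Δ0-sepK , collection , powerSet ext Δ0-sep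
  where
    open WithEquality S ≐-refl ≐-sym ≐-trans ≐-∈ˡ ≐-∈ʳ
    open Embedding M-transitive j∈M elementary
    open CriticalPoint K K-transitive K∈jK j-fixes
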